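{- For every $m\ge0$ and every closed value $M$: (1) $\mathtt{W2S}\,\overline{0}\to^+\underline{0}$; (2) $\mathtt{W2S}\,\overline{2^m+2^{m-1}\nu_{m-1}+\dots+2^0\nu_0}\to^+\underline{m+1}$ for all $\nu_0,\dots,\nu_{m-1}\in\{0,1\}$; (3) $\mathtt{S2L}\,M\,\underline{m}\to^+[\underbrace{M,\dots,M}_{m}]$.
   Context: Pure $\lambda$-terms $M::=x\mid\lambda x.M\mid MN$; values are variables and abstractions; $\mathrm{nocc}(x,M)$ is the number of free occurrences of $x$ in $M$. The reduction $\to$ is the contextual closure of $(\lambda x.M)N\blacktriangleright M\{N/x\}$, allowed iff $\mathrm{nocc}(x,M)=0$, or $\mathrm{nocc}(x,M)=1$ and $N$ is a value, or $\mathrm{nocc}(x,M)>1$, $N$ is a value and $FV(N)\subseteq\{y\}$ for some variable $y$; $\to^+$ is its transitive closure. $I\equiv\lambda x.x$. Strings: $\underline{0}\equiv\lambda f y.y$, $\underline{m}\equiv\lambda f y.f(\cdots(f\,y)\cdots)$ with $m$ occurrences of $f$. Words (binary numerals, with two bound variables named $0$ and $1$): $\overline{0}\equiv\lambda 0\,1\,y.y$ and $\overline{2^m+2^{m-1}\nu_{m-1}+\dots+2^0\nu_0}\equiv\lambda 0\,1\,y.\,\nu_0(\cdots(\nu_{m-1}(1\,y))\cdots)$, where each $\nu_i\in\{0,1\}$ is read as the corresponding bound variable. Lists: $\mathbf{nil}\equiv\lambda c x.x$ and $[M_1,\dots,M_m]\equiv\lambda c x.\,c\,M_1(\cdots(c\,M_m\,x)\cdots)$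 for $m\ge1$ (so $[\,]$ with $m=0$ is $\mathbf{nil}$). $\mathtt{W2S}\equiv\lambda n f.(\lambda z y.\,z\,y)(n\,f\,f)$ and $\mathtt{S2L}\equiv\lambda k n c.(\lambda z x.\,z\,(\lambda f.x)\,I)(n\,(\lambda l f.\,c\,k\,(l\,I)))$. -}

module Defs where

open import Data.Nat using (ℕ; zero; suc; _<_; _<ᵇ_; _≡ᵇ_; compare; less; equal; greater; _+_)
open import Data.Bool using (Bool; true; false; if_then_else_)
open import Data.List using (List; []; _∷_)
open import Data.Vec using (Vec; []; _∷_)
open import Data.Product using (_×_; ∃)
open import Data.Sum using (_⊎_)
open import Relation.Binary.PropositionalEquality using (_≡_)
open import Relation.Nullary using (¬_)
open import Relation.Binary.Construct.Closure.Transitive using (TransClosure)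

data Term : Set where
  var : ℕ → Term
  lam : Term → Term
  app : Term → Term → Term

data Value : Term → Set where
  var : ∀ x → Value (var x)
  lam : ∀ M → Value (lam M)

data FreeIn : ℕ → Term → Set where
  var  : ∀ x → FreeIn x (var x)
  lam  : ∀ {x M} → FreeIn (suc x) M → FreeIn x (lam M)
  appl : ∀ {x M N} → FreeIn x M → FreeIn x (app M N)
  appr : ∀ {x M N} → FreeIn x N → FreeIn x (app M N)

Closed : Term → Set
Closed M = ∀ x → ¬ FreeIn x M

nocc : ℕ → Term → ℕ
nocc k (var x)   = if x ≡ᵇ k then 1 else 0
nocc k (lam M)   = nocc (suc k) M
nocc k (app M N) = nocc k M + nocc k N

shift : ℕ → Term → Term
shift c (var x)   = if x <ᵇ c then var x else var (suc x)
shift c (lam M)   = lam (shift (suc c) M)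
shift c (app M N) = app (shift c M) (shift c N)

subst : ℕ → Term → Term → Term
subst k N (var x) with compare x k
... | less _ _      = var x
... | equal _       = N
... | greater _ j   = var (k + j)
subst k N (lam M)   = lam (subst (suc k) (shift 0 N) M)
subst k N (app M N') = app (subst k N M) (subst k N N')

BetaOK : Term → Term → Set
BetaOK M N =
  (nocc 0 M ≡ 0)
  ⊎ ((nocc 0 M ≡ 1) × Value N)
  ⊎ ((1 < nocc 0 M) × Value N × ∃ λ y → ∀ z → FreeIn z N → z ≡ y)

infix 4 _⟶_ _⟶⁺_
data _⟶_ : Term → Term → Set where
  beta : ∀ {M N} → BetaOK M N → app (lam M) N ⟶ subst 0 N M
  ξlam : ∀ {M M'} → M ⟶ M' → lam M ⟶ lam M'
  ξappl : ∀ {M M' N} → M ⟶ M' → app M N ⟶ app M' N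
  ξappr : ∀ {M N N'} → N ⟶ N' → app M N ⟶ app M N'

_⟶⁺_ : Term → Term → Set
_⟶⁺_ = TransClosure _⟶_

I : Term
I = lam (var 0)

-- strings  m̲ ≡ λf y. f(⋯(f y)⋯)   (f = index 1, y = index 0)
strBody : ℕ → Term
strBody zero    = var 0
strBody (suc m) = app (var 1) (strBody m)

str : ℕ → Term
str m = lam (lam (strBody m))

-- words: λ 0 1 y. ν₀(⋯(ν_{m-1}(1 y))⋯); bound "0" = index 2, "1" = index 1, y = index 0
-- bit false reads as the variable 0, true as the variable 1
bitVar : Bool → Term
bitVar false = var 2
bitVar true  = var 1

wordBody : ∀ {m} → Vec Bool m → Term
wordBody []       = app (var 1) (var 0)
wordBody (ν ∷ νs) = app (bitVar ν) (wordBody νs)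

word0 : Term
word0 = lam (lam (lam (var 0)))

-- word for 2^m + 2^{m-1}ν_{m-1} + ... + ν₀, given (ν₀ , … , ν_{m-1})
word : ∀ {m} → Vec Bool m → Term
word νs = lam (lam (lam (wordBody νs)))

-- lists: λc x. c M₁ (⋯ (c M_m x)⋯)  (c = index 1, x = index 0)
listBody : List Term → Term
listBody []       = var 0
listBody (M ∷ Ms) = app (app (var 1) (shift 0 (shift 0 M))) (listBody Ms)

lst : List Term → Term
lst Ms = lam (lam (listBody Ms))

-- W2S ≡ λn f.(λz y. z y)(n f f)
W2S : Term
W2S = lam (lam (app (lam (lam (app (var 1) (var 0))))
                    (app (app (var 1) (var 0)) (var 0))))

-- S2L ≡ λk n c.(λz x. z (λf.x) I)(n (λl f. c k (l I)))
S2L : Term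
S2L = lam (lam (lam
        (app (lam (lam (app (app (var 1) (lam (var 1))) I)))
             (app (var 1) (lam (lam (app (app (var 2) (var 4)) (app (var 1) I))))))))

module Submission where

-- Each claim is proved by exhibiting an explicit reduction sequence and
-- checking, for every β-step, the side condition of the restricted rule.  In
-- all steps used the argument is either a value substituted linearly, or a
-- value with at most one free variable, so two admissibility criteria suffice.
-- Uniformity in m rests on two syntactic facts developed first:
--   * a term whose free indices lie below c is fixed by shifting and by
--     substitution at indices ≥ c, and has no occurrence of such indices; in
--     particular the closed value M passes through binders untouched;
--   * strings and list bodies are iterated applications G (G (⋯ X)), and
--     shifting and substitution distribute over iteration.  For part (3),
-- S2L M m̲ reduces to λc x. Gᵐ (λf.x) I with G = λl f. c M (l I); each G
-- contributes one list cell c M (⋯), and the final application to I yields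
-- the list [M,…,M].

open import Defs
open import Data.Nat using (ℕ; zero; suc; _<_; z≤n; s≤s; compare; less; equal; greater; _<ᵇ_; _≡ᵇ_)
open import Data.Nat.Properties using (<⇒<ᵇ; ≡ᵇ⇒≡; <-irrefl; <⇒≱; ≤-trans; m≤m+n; n≤1+n)
open import Data.Bool using (Bool; true; false)
open import Data.Vec using (Vec; []; _∷_)
open import Data.List using (replicate)
open import Data.Product using (_×_; _,_)
open import Data.Sum using (inj₁; inj₂)
open import Data.Empty using (⊥-elim)
open import Relation.Binary.PropositionalEquality using (_≡_; refl; cong; cong₂; sym; trans)
open import Relation.Binary.Construct.Closure.Transitive using ([_]; _∷_)
open import Relation.Binary.Construct.Closure.ReflexiveTransitive using (Star; ε; _◅_; _◅◅_; gmap)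

Bounded : ℕ → Term → Set
Bounded c M = ∀ x → FreeIn x M → x < c

bounded-lam : ∀ {c M} → Bounded c (lam M) → Bounded (suc c) M
bounded-lam h zero    _  = s≤s z≤n
bounded-lam h (suc x) fi = s≤s (h x (lam fi))

bounded-appˡ : ∀ {c M N} → Bounded c (app M N) → Bounded c M
bounded-appˡ h x fi = h x (appl fi)

bounded-appʳ : ∀ {c M N} → Bounded c (app M N) → Bounded c N
bounded-appʳ h x fi = h x (appr fi)

closed⇒bounded : ∀ {M} c → Closed M → Bounded c M
closed⇒bounded c cl x fi = ⊥-elim (cl x fi)

shift-bounded : ∀ c M → Bounded c M → shift c M ≡ M
shift-bounded c (var x) h with x <ᵇ c | <⇒<ᵇ (h x (var x))
... | true | _ = refl
shift-bounded c (lam M)   h = cong lam (shift-bounded (suc c) M (bounded-lam h))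
shift-bounded c (app M N) h =
  cong₂ app (shift-bounded c M (bounded-appˡ h)) (shift-bounded c N (bounded-appʳ h))

subst-below : ∀ x k N → x < k → subst k N (var x) ≡ var x
subst-below x k N x<k with compare x k
... | less _ _    = refl
... | equal _     = ⊥-elim (<-irrefl refl x<k)
... | greater _ j = ⊥-elim (<⇒≱ x<k (≤-trans (m≤m+n k j) (n≤1+n _)))

subst-bounded : ∀ k N M → Bounded k M → subst k N M ≡ M
subst-bounded k N (var x)    h = subst-below x k N (h x (var x))
subst-bounded k N (lam M)    h = cong lam (subst-bounded (suc k) (shift 0 N) M (bounded-lam h))
subst-bounded k N (app M M') h =
  cong₂ app (subst-bounded k N M (bounded-appˡ h)) (subst-bounded k N M' (bounded-appʳ h))

nocc-bounded : ∀ k M → Bounded k M → nocc k M ≡ 0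
nocc-bounded k (var x) h with x ≡ᵇ k | ≡ᵇ⇒≡ x k
... | false | _   = refl
... | true  | x≡k = ⊥-elim (<-irrefl (x≡k _) (h x (var x)))
nocc-bounded k (lam M) h = nocc-bounded (suc k) M (bounded-lam h)
nocc-bounded k (app M N) h
  rewrite nocc-bounded k M (bounded-appˡ h) | nocc-bounded k N (bounded-appʳ h) = refl

iter : Term → Term → ℕ → Term
iter G X zero    = X
iter G X (suc n) = app G (iter G X n)

iter-shift : ∀ k G X n → shift k (iter G X n) ≡ iter (shift k G) (shift k X) n
iter-shift k G X zero    = refl
iter-shift k G X (suc n) = cong (app (shift k G)) (iter-shift k G X n)

iter-subst : ∀ k N G X n → subst k N (iter G X n) ≡ iter (subst k N G) (subst k N X) n
iter-subst k N G X zero    = refl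
iter-subst k N G X (suc n) = cong (app (subst k N G)) (iter-subst k N G X n)

-- Applying a string λf y. fⁿ y to G yields λy. Gⁿ y.
strBody-subst : ∀ G n → subst 1 G (strBody n) ≡ iter G (var 0) n
strBody-subst G zero    = refl
strBody-subst G (suc n) = cong (app G) (strBody-subst G n)

strBody-shift : ∀ n → shift 2 (strBody n) ≡ strBody n
strBody-shift zero    = refl
strBody-shift (suc n) = cong (app (var 1)) (strBody-shift n)

-- η-like contraction (λy. fⁿ y) y ⟶ fⁿ y, at the level of the substitution.
strBody-contract : ∀ n → subst 0 (var 0) (shift 1 (strBody n)) ≡ strBody n
strBody-contract zero    = refl
strBody-contract (suc n) = cong (app (var 1)) (strBody-contract n)

-- Instantiating both bit variables of a word body by f gives f^{m+1} y:
-- every digit, and the leading 1, becomes one application of f.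
wordBody-collapse : ∀ {m} (νs : Vec Bool m) →
  subst 1 (var 1) (subst 2 (var 2) (shift 3 (wordBody νs))) ≡ strBody (suc m)
wordBody-collapse []           = refl
wordBody-collapse (false ∷ νs) = cong (app (var 1)) (wordBody-collapse νs)
wordBody-collapse (true ∷ νs)  = cong (app (var 1)) (wordBody-collapse νs)

listBody-replicate : ∀ N n →
  listBody (replicate n N) ≡ iter (app (var 1) (shift 0 (shift 0 N))) (var 0) n
listBody-replicate N zero    = refl
listBody-replicate N (suc n) = cong (app _) (listBody-replicate N n)

β-unary : ∀ {M N} y → Value N → (∀ z → FreeIn z N → z ≡ y) →
  app (lam M) N ⟶ subst 0 N M
β-unary {M} {N} y v fv with nocc 0 M in occurrences
... | zero        = beta (inj₁ occurrences)
... | suc zero    = beta (inj₂ (inj₁ (occurrences , v)))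
... | suc (suc _) = beta (inj₂ (inj₂ (many , v , y , fv)))
  where
  many : 1 < nocc 0 M
  many rewrite occurrences = s≤s (s≤s z≤n)

β-var : ∀ {M x} → app (lam M) (var x) ⟶ subst 0 (var x) M
β-var {x = x} = β-unary x (var x) λ { _ (var _) → refl }

β-linear : ∀ {M N} → Value N → nocc 0 M ≡ 1 → app (lam M) N ⟶ subst 0 N M
β-linear v once = beta (inj₂ (inj₁ (once , v)))

I-unary : ∀ z → FreeIn z I → z ≡ 0
I-unary z (lam ())

K-unary : ∀ z → FreeIn z (lam (var 1)) → z ≡ 0
K-unary z (lam (var _)) = refl

_⟶by_ : ∀ {A B B'} → A ⟶ B → B ≡ B' → A ⟶ B'
s ⟶by refl = s

infix 4 _⟶*_
_⟶*_ : Term → Term → Set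
_⟶*_ = Star _⟶_

infix 4 _▸_
_▸_ : ∀ {A B C} → A ⟶* B → B ⟶ C → A ⟶⁺ C
ε       ▸ s = [ s ]
(t ◅ p) ▸ s = t ∷ (p ▸ s)

w2s-zero : app W2S word0 ⟶⁺ str 0
w2s-zero =
  β-linear (lam _) refl
  ∷ ξlam (ξappr (ξappl β-var))
  ∷ ξlam (ξappr β-var)
  ∷ ξlam (β-linear (lam _) refl)
  ∷ [ ξlam (ξlam β-var) ]

w2s-word : ∀ {m} (νs : Vec Bool m) → app W2S (word νs) ⟶⁺ str (suc m)
w2s-word {m} νs =
  β-linear (lam _) refl
  ∷ ξlam (ξappr (ξappl β-var))
  ∷ ξlam (ξappr (β-var ⟶by cong lam (wordBody-collapse νs)))
  ∷ ξlam (β-linear (lam _) refl)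
  ∷ [ ξlam (ξlam (β-var ⟶by strBody-contract (suc m))) ]

module S2L-reduction (M : Term) (closed : Closed M) (value : Value M) where

  shift-M : ∀ c → shift c M ≡ M
  shift-M c = shift-bounded c M (closed⇒bounded c closed)

  subst-M : ∀ k N → subst k N M ≡ M
  subst-M k N = subst-bounded k N M (closed⇒bounded k closed)

  nocc-M : ∀ k → nocc k M ≡ 0
  nocc-M k = nocc-bounded k M (closed⇒bounded k closed)

  -- Z ≡ λz x. z (λf.x) I, the finaliser inside S2L.
  Z : Term
  Z = lam (lam (app (app (var 1) (lam (var 1))) I))

  -- λl f. c X (l I), the function S2L iterates over the string; the list
  -- constructor c is the index c, counted under the two binders.
  StepOf : ℕ → Term → Term
  StepOf c X = lam (lam (app (app (var c) X) (app (var 1) I)))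

  Step : ℕ → Term
  Step c = StepOf c M

  cells : Term → Term → ℕ → Term
  cells c = iter (app c M)

  shift-cells : ∀ k c x n → shift k (cells c x n) ≡ cells (shift k c) (shift k x) n
  shift-cells k c x n =
    trans (iter-shift k (app c M) x n) (cong (λ N → iter (app (shift k c) N) (shift k x) n) (shift-M k))

  subst-cells : ∀ k N c x n → subst k N (cells c x n) ≡ cells (subst k N c) (subst k N x) n
  subst-cells k N c x n =
    trans (iter-subst k N (app c M) x n) (cong (λ P → iter (app (subst k N c) P) (subst k N x) n) (subst-M k N))

  -- Step 2 has the single free variable c, so it may be duplicated by β.
  Step-unary : ∀ z → FreeIn z (Step 2) → z ≡ 0
  Step-unary z (lam (lam (appl (appl (var _))))) = refl
  Step-unary z (lam (lam (appl (appr fi))))      = ⊥-elim (closed _ fi)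
  Step-unary z (lam (lam (appr (appr (lam ())))))

  shift-Step₀ : shift 0 (Step 2) ≡ Step 3
  shift-Step₀ = cong (StepOf 3) (shift-M 2)

  shift-Step₁ : shift 1 (Step 3) ≡ Step 4
  shift-Step₁ = cong (StepOf 4) (shift-M 3)

  subst-Step : ∀ N → subst 0 N (Step 4) ≡ Step 3
  subst-Step N = cong (StepOf 3) (subst-M 2 (shift 0 (shift 0 N)))

  Step-linear : nocc 0 (lam (app (app (var 3) M) (app (var 1) I))) ≡ 1
  Step-linear rewrite nocc-M 1 = refl

  S2L-linear : nocc 0 (lam (app Z (app (var 1) (Step 2)))) ≡ 1
  S2L-linear rewrite nocc-M 3 = refl

  -- Substituting M for k in S2L carries it under four binders.
  M-shifted : shift 0 (shift 0 (shift 0 (shift 0 M))) ≡ M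
  M-shifted rewrite shift-M 0 | shift-M 0 | shift-M 0 | shift-M 0 = refl

  s2l-unfold : ∀ m → app (app S2L M) (str m) ⟶* lam (app Z (lam (iter (Step 3) (var 0) m)))
  s2l-unfold m =
    ξappl (β-linear value refl
            ⟶by cong (λ X → lam (lam (app Z (app (var 1) (StepOf 2 X))))) M-shifted)
    ◅ (β-linear (lam _) S2L-linear
        ⟶by cong₂ (λ A X → lam (app Z (app (lam (lam A)) (StepOf 2 X))))
                  (strBody-shift m) (subst-M 3 _))
    ◅ ξlam (ξappr (β-unary 0 (lam _) Step-unary
        ⟶by cong lam (trans (cong (λ G → subst 1 G (strBody m)) shift-Step₀)
                            (strBody-subst (Step 3) m))))
    ◅ ε

  z-fire : ∀ m → lam (app Z (lam (iter (Step 3) (var 0) m))) ⟶* lam (lam (app (iter (Step 3) (lam (var 1)) m) I))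
  z-fire m =
    ξlam (β-linear (lam _) refl
           ⟶by cong (λ X → lam (app (app (lam X) (lam (var 1))) I))
                    (trans (iter-shift 1 (Step 3) (var 0) m)
                           (cong (λ G → iter G (var 0) m) shift-Step₁)))
    ◅ ξlam (ξlam (ξappl (β-unary 0 (lam _) K-unary
        ⟶by trans (iter-subst 0 (lam (var 1)) (Step 4) (var 0) m)
                  (cong (λ G → iter G (lam (var 1)) m) (subst-Step (lam (var 1)))))))
    ◅ ε

  -- One Step adds one cell: Step (λf. L) ⟶ λf. c M ((λf. L) I) ⟶ λf. c M L.
  step-cell : ∀ n → app (Step 3) (lam (cells (var 2) (var 1) n)) ⟶* lam (cells (var 2) (var 1) (suc n))
  step-cell n =
    (β-linear (lam _) Step-linear
      ⟶by cong (λ X → lam (app (app (var 2) X) (app (lam (shift 1 (cells (var 2) (var 1) n))) I)))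
               (subst-M 1 _))
    ◅ ξlam (ξappr (β-unary 0 (lam _) I-unary
        ⟶by trans (cong (subst 0 I) (shift-cells 1 (var 2) (var 1) n))
                  (subst-cells 0 I (var 3) (var 2) n)))
    ◅ ε

  step-cells : ∀ n → iter (Step 3) (lam (var 1)) n ⟶* lam (cells (var 2) (var 1) n)
  step-cells zero    = ε
  step-cells (suc n) = gmap (app (Step 3)) ξappr (step-cells n) ◅◅ step-cell n

  list-cells : ∀ m → listBody (replicate m M) ≡ cells (var 1) (var 0) m
  list-cells m = trans (listBody-replicate M m) (cong (λ X → iter (app (var 1) X) (var 0) m) M-shifted₂)
    where
    M-shifted₂ : shift 0 (shift 0 M) ≡ M
    M-shifted₂ rewrite shift-M 0 | shift-M 0 = refl

  s2l-finish : ∀ m → lam (lam (app (lam (cells (var 2) (var 1) m)) I)) ⟶ lst (replicate m M)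
  s2l-finish m =
    ξlam (ξlam (β-unary 0 (lam _) I-unary
      ⟶by trans (subst-cells 0 I (var 2) (var 1) m) (sym (list-cells m))))

  s2l : ∀ m → app (app S2L M) (str m) ⟶⁺ lst (replicate m M)
  s2l m =
    s2l-unfold m
    ◅◅ z-fire m
    ◅◅ gmap (λ X → lam (lam (app X I))) (λ s → ξlam (ξlam (ξappl s))) (step-cells m)
    ▸ s2l-finish m

mainTheorem7 : (m : ℕ) (M : Term) → Closed M → Value M →
    (app W2S word0 ⟶⁺ str 0)
    × (∀ (νs : Vec Bool m) → app W2S (word νs) ⟶⁺ str (suc m))
    × (app (app S2L M) (str m) ⟶⁺ lst (replicate m M))
mainTheorem7 m M closed value =
  w2s-zero , w2s-word , S2L-reduction.s2l M closed value m
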